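{- Define $h_n(x)$ for $n\ge 0$ by $h_0(x)=1$ and, for $n\ge 1$, $$h_n(x)=\sum_{k=1}^{n}\binom{\mathbf{n}}{\mathbf{k}}\,(1-x^{n-1})(1-x^{n-2})\cdots(1-x^{n-k+1})\;h_{n-k}(x)\,x^{\,n-k+\frac{k(k-1)}{2}},$$ where for $k=1$ the product $(1-x^{n-1})\cdots(1-x^{n-k+1})$ is empty and equals $1$. Then each $h_n(x)$ is a polynomial in $x$ with integer coefficients, and, as formal power series in $a$ and $x$, $$\prod_{m=1}^{\infty}(1+ax^m)^{m}=1+\sum_{n=1}^{\infty}\frac{h_n(x)\,x^n}{\bigl[(1-x)(1-x^2)\cdots(1-x^n)\bigr]^2}\,a^n .$$
   Context: For integers $0\le k\le n$, the Gaussian polynomial is $\binom{\mathbf{n}}{\mathbf{k}}=\dfrac{(1-x^{n-k+1})(1-x^{n-k+2})\cdots(1-x^{n})}{(1-x)(1-x^2)\cdots(1-x^{k})}$ (equal to $1$ for $k=0$ and $k=n$); it is a polynomial in $x$ with nonnegative integer coefficients. -}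

module Defs where

open import Data.Nat as ℕ using (ℕ; zero; suc; _∸_; _≡ᵇ_; _<_)
open import Data.Integer using (ℤ; 0ℤ; 1ℤ; _+_; _*_; -_; _-_)
open import Data.List using (List; []; _∷_; map; foldr; upTo)
open import Data.Bool using (if_then_else_)
open import Data.Product using (_×_; ∃)
open import Relation.Binary.PropositionalEquality using (_≡_)

-- Formal power series in x with integer coefficients: n ↦ coefficient of x^n.
Ser : Set
Ser = ℕ → ℤ

sumℤ : List ℤ → ℤ
sumℤ = foldr _+_ 0ℤ

zeroS : Ser
zeroS _ = 0ℤ

oneS : Ser
oneS zero    = 1ℤ
oneS (suc _) = 0ℤ

xpow : ℕ → Ser
xpow e j = if e ≡ᵇ j then 1ℤ else 0ℤ

addS : Ser → Ser → Ser
addS f g j = f j + g j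

subS : Ser → Ser → Ser
subS f g j = f j - g j

mulS : Ser → Ser → Ser
mulS f g j = sumℤ (map (λ i → f i * g (j ∸ i)) (upTo (suc j)))

prodS : List Ser → Ser
prodS = foldr mulS oneS

nthOr : {A : Set} → A → List A → ℕ → A
nthOr d []       _       = d
nthOr d (x ∷ xs) zero    = x
nthOr d (x ∷ xs) (suc i) = nthOr d xs i

-- Multiplicative inverse of a series f with f_0 = 1:
-- g_0 = 1, g_j = - Σ_{i=1}^{j} f_i g_{j-i}.
-- invList f j = [g_j, g_{j-1}, …, g_0].
invList : Ser → ℕ → List ℤ
invList f zero    = 1ℤ ∷ []
invList f (suc j) =
  (- sumℤ (map (λ i → f (suc i) * nthOr 0ℤ prev i) (upTo (suc j)))) ∷ prev
  where prev = invList f j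

invS : Ser → Ser
invS f j = nthOr 0ℤ (invList f j) 0

oneMinusX : ℕ → Ser
oneMinusX e = subS oneS (xpow e)

qpoch : ℕ → Ser
qpoch n = prodS (map (λ i → oneMinusX (suc i)) (upTo n))

-- Gaussian polynomial [n choose k] =
--   (1-x^{n-k+1})…(1-x^n) / ((1-x)…(1-x^k)), as a power series in x.
gauss : ℕ → ℕ → Ser
gauss n k = mulS (prodS (map (λ i → oneMinusX ((n ∸ k) ℕ.+ suc i)) (upTo k)))
                 (invS (qpoch k))

partProd : ℕ → ℕ → Ser
partProd n k = prodS (map (λ i → oneMinusX (n ∸ suc i)) (upTo (k ∸ 1)))

expo : ℕ → ℕ → ℕ
expo n k = (n ∸ k) ℕ.+ ((k ℕ.* (k ∸ 1)) ℕ./ 2)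

-- hList n = [h_n, h_{n-1}, …, h_0]
hList : ℕ → List Ser
hList zero    = oneS ∷ []
hList (suc m) = new ∷ prev
  where
    n    = suc m
    prev = hList m
    -- term for k = suc i (i = 0 … n-1); h_{n-k} = h_{m-i} is at index i of prev
    term : ℕ → Ser
    term i = mulS (mulS (mulS (gauss n (suc i)) (partProd n (suc i)))
                        (nthOr zeroS prev i))
                  (xpow (expo n (suc i)))
    new : Ser
    new j = sumℤ (map (λ i → term i j) (upTo n))

h : ℕ → Ser
h n = nthOr zeroS (hList n) 0

-- Formal power series in a and x: i ↦ (coefficient of a^i, a series in x).
Ser2 : Set
Ser2 = ℕ → Ser

oneS2 : Ser2
oneS2 zero    = oneS
oneS2 (suc _) = zeroS

mulS2 : Ser2 → Ser2 → Ser2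
mulS2 F G i j = sumℤ (map (λ l → mulS (F l) (G (i ∸ l)) j) (upTo (suc i)))

powS2 : Ser2 → ℕ → Ser2
powS2 F zero    = oneS2
powS2 F (suc k) = mulS2 F (powS2 F k)

linFactor : ℕ → Ser2
linFactor m zero          = oneS
linFactor m (suc zero)    = xpow m
linFactor m (suc (suc _)) = zeroS

prodUpTo : ℕ → Ser2
prodUpTo M = foldr (λ i acc → mulS2 (powS2 (linFactor (suc i)) (suc i)) acc) oneS2 (upTo M)

-- Coefficient of a^i x^j in the infinite product ∏_{m≥1} (1 + a x^m)^m:
-- factors with m > j do not affect the x^j coefficient, so it equals the
-- coefficient in the finite product up to m = j (x-adic limit).
infProd : Ser2
infProd i j = prodUpTo j i j

rhsSeries : Ser2
rhsSeries zero    = oneS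
rhsSeries (suc m) =
  mulS (mulS (h (suc m)) (xpow (suc m))) (invS (mulS (qpoch (suc m)) (qpoch (suc m))))

module Submission where

-- Let F(a) = Σₙ Fₙ aⁿ with Fₙ = hₙ xⁿ / (x;x)ₙ² (rhsCoeff), and E(a) = Σₖ Eₖ aᵏ
-- with Eₖ = x^(k(k+1)/2) / (x;x)ₖ (eulerCoeff), which is ∏_{m ≥ 1} (1 + a xᵐ) by
-- Euler. Multiplied by the unit (x;x)ₙ (x;x)ₙ₋₁, the recurrence defining hₙ becomes
-- Fₙ (1 - xⁿ) = Σ_{k=1}^{n} Eₖ x^(n-k) Fₙ₋ₖ, that is, F(a) = E(a) F(a x); likewise
-- E(a) = (1 + a x) E(a x). The finite products S_M = ∏_{m ≤ M} (1 + a xᵐ) and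
-- P_M = ∏_{m ≤ M} (1 + a xᵐ)ᵐ obey the same equations up to an index shift,
-- S_{M+1}(a) = (1 + a x) S_M(a x) and P_{M+1}(a) = S_{M+1}(a) P_M(a x), because
-- (1 + a xᵐ⁺¹)ᵐ⁺¹ = (1 + a xᵐ⁺¹) (1 + (a x) xᵐ)ᵐ. Since a ↦ a x raises the x-degree of
-- every positive power of a, induction on M gives S_M ≡ E and P_M ≡ F modulo x^(M+1).
-- Polynomiality of hₙ follows from its recurrence, the Gaussian polynomials being
-- polynomials by the q-Pascal rule.

open import Algebra using (CommutativeMonoid; CommutativeRing)
open import Level using (0ℓ)
open import Data.Nat as ℕ using (ℕ; zero; suc; _∸_; _<_; _≤_; z≤n; s≤s)
import Data.Nat.Properties as ℕₚ
open import Data.Integer as ℤ using (ℤ; 0ℤ; 1ℤ)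
import Data.Integer.Properties as ℤₚ
open import Data.List using ([]; _∷_; map; foldr; upTo; applyUpTo)
import Data.List.Properties as Listₚ
open import Data.Product using (_×_; _,_; ∃)
open import Function using (_∘_)
open import Relation.Nullary using (yes; no)
open import Relation.Binary.PropositionalEquality as ≡ using (_≡_)
open import Defs

module FiniteSum {c ℓ} (M : CommutativeMonoid c ℓ) where
  open CommutativeMonoid M renaming (Carrier to A)
  open import Relation.Binary.Reasoning.Setoid setoid

  ∑< : ℕ → (ℕ → A) → A
  ∑< zero    f = ε
  ∑< (suc n) f = ∑< n f ∙ f n

  ∑<-cong : ∀ n {f g : ℕ → A} → (∀ i → i < n → f i ≈ g i) → ∑< n f ≈ ∑< n g
  ∑<-cong zero    f≈g = refl
  ∑<-cong (suc n) f≈g = ∙-cong (∑<-cong n (λ i i<n → f≈g i (ℕₚ.m<n⇒m<1+n i<n))) (f≈g n ℕₚ.≤-refl)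

  ∑<-ε : ∀ n {f : ℕ → A} → (∀ i → i < n → f i ≈ ε) → ∑< n f ≈ ε
  ∑<-ε zero    f≈ε = refl
  ∑<-ε (suc n) f≈ε = trans (∙-cong (∑<-ε n (λ i i<n → f≈ε i (ℕₚ.m<n⇒m<1+n i<n))) (f≈ε n ℕₚ.≤-refl)) (identityˡ ε)

  ∑<-suc-head : ∀ n (f : ℕ → A) → ∑< (suc n) f ≈ f 0 ∙ ∑< n (f ∘ suc)
  ∑<-suc-head zero    f = trans (identityˡ _) (sym (identityʳ _))
  ∑<-suc-head (suc n) f = begin
    ∑< (suc n) f ∙ f (suc n)           ≈⟨ ∙-congʳ (∑<-suc-head n f) ⟩
    (f 0 ∙ ∑< n (f ∘ suc)) ∙ f (suc n) ≈⟨ assoc _ _ _ ⟩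
    f 0 ∙ ∑< (suc n) (f ∘ suc)         ∎

  ∑<-∙ : ∀ n (f g : ℕ → A) → ∑< n (λ i → f i ∙ g i) ≈ ∑< n f ∙ ∑< n g
  ∑<-∙ zero    f g = sym (identityˡ ε)
  ∑<-∙ (suc n) f g = begin
    ∑< n (λ i → f i ∙ g i) ∙ (f n ∙ g n) ≈⟨ ∙-congʳ (∑<-∙ n f g) ⟩
    (∑< n f ∙ ∑< n g) ∙ (f n ∙ g n)      ≈⟨ assoc _ _ _ ⟩
    ∑< n f ∙ (∑< n g ∙ (f n ∙ g n))      ≈⟨ ∙-congˡ (sym (assoc _ _ _)) ⟩
    ∑< n f ∙ ((∑< n g ∙ f n) ∙ g n)      ≈⟨ ∙-congˡ (∙-congʳ (comm _ _)) ⟩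
    ∑< n f ∙ ((f n ∙ ∑< n g) ∙ g n)      ≈⟨ ∙-congˡ (assoc _ _ _) ⟩
    ∑< n f ∙ (f n ∙ (∑< n g ∙ g n))      ≈⟨ sym (assoc _ _ _) ⟩
    (∑< n f ∙ f n) ∙ (∑< n g ∙ g n)      ∎

  ∑<-+ : ∀ a b (f : ℕ → A) → ∑< (a ℕ.+ b) f ≈ ∑< a f ∙ ∑< b (λ i → f (a ℕ.+ i))
  ∑<-+ a zero    f = ≡.subst (λ k → ∑< k f ≈ ∑< a f ∙ ε) (≡.sym (ℕₚ.+-identityʳ a)) (sym (identityʳ _))
  ∑<-+ a (suc b) f = begin
    ∑< (a ℕ.+ suc b) f                               ≡⟨ ≡.cong (λ k → ∑< k f) (ℕₚ.+-suc a b) ⟩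
    ∑< (a ℕ.+ b) f ∙ f (a ℕ.+ b)                     ≈⟨ ∙-congʳ (∑<-+ a b f) ⟩
    (∑< a f ∙ ∑< b (λ i → f (a ℕ.+ i))) ∙ f (a ℕ.+ b) ≈⟨ assoc _ _ _ ⟩
    ∑< a f ∙ ∑< (suc b) (λ i → f (a ℕ.+ i))          ∎

  ∑<-reverse : ∀ n (f : ℕ → A) → ∑< n (λ i → f (n ∸ suc i)) ≈ ∑< n f
  ∑<-reverse zero    f = refl
  ∑<-reverse (suc n) f = begin
    ∑< (suc n) (λ i → f (n ∸ i))       ≈⟨ ∑<-suc-head n _ ⟩
    f n ∙ ∑< n (λ i → f (n ∸ suc i))   ≈⟨ ∙-congˡ (∑<-reverse n f) ⟩
    f n ∙ ∑< n f                       ≈⟨ comm _ _ ⟩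
    ∑< (suc n) f                       ∎

  foldr-applyUpTo : ∀ n (f : ℕ → A) → foldr _∙_ ε (applyUpTo f n) ≈ ∑< n f
  foldr-applyUpTo zero    f = refl
  foldr-applyUpTo (suc n) f = begin
    f 0 ∙ foldr _∙_ ε (applyUpTo (f ∘ suc) n) ≈⟨ ∙-congˡ (foldr-applyUpTo n (f ∘ suc)) ⟩
    f 0 ∙ ∑< n (f ∘ suc)                       ≈⟨ sym (∑<-suc-head n f) ⟩
    ∑< (suc n) f                               ∎

  foldr-map-upTo : ∀ n (f : ℕ → A) → foldr _∙_ ε (map f (upTo n)) ≈ ∑< n f
  foldr-map-upTo n f = trans (reflexive (≡.cong (foldr _∙_ ε) (Listₚ.map-upTo f n))) (foldr-applyUpTo n f)

module PowerSeries {c ℓ} (R : CommutativeRing c ℓ) where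
  open CommutativeRing R renaming (Carrier to A)
  open import Relation.Binary.Reasoning.Setoid setoid
  open FiniteSum +-commutativeMonoid public

  ∑<-*ˡ : ∀ n a (f : ℕ → A) → a * ∑< n f ≈ ∑< n (λ i → a * f i)
  ∑<-*ˡ zero    a f = zeroʳ a
  ∑<-*ˡ (suc n) a f = trans (distribˡ _ _ _) (+-congʳ (∑<-*ˡ n a f))

  ∑<-*ʳ : ∀ n (f : ℕ → A) a → ∑< n f * a ≈ ∑< n (λ i → f i * a)
  ∑<-*ʳ n f a = trans (*-comm _ a) (trans (∑<-*ˡ n a f) (∑<-cong n (λ i _ → *-comm a (f i))))

  Series : Set c
  Series = ℕ → A

  infix 4 _≋_
  _≋_ : Series → Series → Set ℓ
  f ≋ g = ∀ j → f j ≈ g j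

  tail : Series → Series
  tail f j = f (suc j)

  𝟘 : Series
  𝟘 _ = 0#

  𝟙 : Series
  𝟙 zero    = 1#
  𝟙 (suc _) = 0#

  -- Opaque, so that unification treats sums, negations and products of series
  -- as rigid instead of unfolding them pointwise.
  opaque
    infixl 6 _⊕_
    _⊕_ : Series → Series → Series
    (f ⊕ g) j = f j + g j

    ⊝_ : Series → Series
    (⊝ f) j = - f j

    ⊕-at : ∀ f g j → (f ⊕ g) j ≡ f j + g j
    ⊕-at f g j = ≡.refl

    ⊝-at : ∀ f j → (⊝ f) j ≡ - f j
    ⊝-at f j = ≡.refl

    -- The formula of mulS in Defs, so that ⊛-unfold relates the two.
    infixl 7 _⊛_
    _⊛_ : Series → Series → Series
    (f ⊛ g) j = foldr _+_ 0# (map (λ i → f i * g (j ∸ i)) (upTo (suc j)))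

    ⊛-unfold : ∀ f g j → (f ⊛ g) j ≡ foldr _+_ 0# (map (λ i → f i * g (j ∸ i)) (upTo (suc j)))
    ⊛-unfold f g j = ≡.refl

    ⊕-cong : ∀ {f f′ g g′} → f ≋ f′ → g ≋ g′ → f ⊕ g ≋ f′ ⊕ g′
    ⊕-cong f≋f′ g≋g′ j = +-cong (f≋f′ j) (g≋g′ j)

    ⊕-assoc : ∀ f g h → (f ⊕ g) ⊕ h ≋ f ⊕ (g ⊕ h)
    ⊕-assoc f g h j = +-assoc (f j) (g j) (h j)

    ⊕-comm : ∀ f g → f ⊕ g ≋ g ⊕ f
    ⊕-comm f g j = +-comm (f j) (g j)

    ⊕-identityˡ : ∀ f → 𝟘 ⊕ f ≋ f
    ⊕-identityˡ f j = +-identityˡ (f j)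

    ⊕-identityʳ : ∀ f → f ⊕ 𝟘 ≋ f
    ⊕-identityʳ f j = +-identityʳ (f j)

    ⊝-cong : ∀ {f g} → f ≋ g → ⊝ f ≋ ⊝ g
    ⊝-cong f≋g j = -‿cong (f≋g j)

    ⊝-inverseˡ : ∀ f → (⊝ f) ⊕ f ≋ 𝟘
    ⊝-inverseˡ f j = -‿inverseˡ (f j)

    ⊝-inverseʳ : ∀ f → f ⊕ (⊝ f) ≋ 𝟘
    ⊝-inverseʳ f j = -‿inverseʳ (f j)

  scale : A → Series → Series
  scale a f j = a * f j

  ⊛-∑< : ∀ f g j → (f ⊛ g) j ≈ ∑< (suc j) (λ i → f i * g (j ∸ i))
  ⊛-∑< f g j = trans (reflexive (⊛-unfold f g j)) (foldr-map-upTo (suc j) _)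

  ⊛-zero : ∀ f g → (f ⊛ g) 0 ≈ f 0 * g 0
  ⊛-zero f g = trans (reflexive (⊛-unfold f g 0)) (+-identityʳ _)

  ⊛-suc-head : ∀ f g n → (f ⊛ g) (suc n) ≈ f 0 * g (suc n) + (tail f ⊛ g) n
  ⊛-suc-head f g n = begin
    (f ⊛ g) (suc n)                                         ≈⟨ ⊛-∑< f g (suc n) ⟩
    ∑< (suc (suc n)) (λ i → f i * g (suc n ∸ i))            ≈⟨ ∑<-suc-head (suc n) _ ⟩
    f 0 * g (suc n) + ∑< (suc n) (λ i → f (suc i) * g (n ∸ i)) ≈⟨ +-congˡ (sym (⊛-∑< (tail f) g n)) ⟩
    f 0 * g (suc n) + (tail f ⊛ g) n                        ∎

  ⊛-suc-last : ∀ f g n → (f ⊛ g) (suc n) ≈ (f ⊛ tail g) n + f (suc n) * g 0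
  ⊛-suc-last f g n = begin
    (f ⊛ g) (suc n)                                                ≈⟨ ⊛-∑< f g (suc n) ⟩
    ∑< (suc n) (λ i → f i * g (suc n ∸ i)) + f (suc n) * g (n ∸ n) ≈⟨ +-cong (∑<-cong (suc n) shift) (*-congˡ (reflexive (≡.cong g (ℕₚ.n∸n≡0 n)))) ⟩
    ∑< (suc n) (λ i → f i * g (suc (n ∸ i))) + f (suc n) * g 0     ≈⟨ +-congʳ (sym (⊛-∑< f (tail g) n)) ⟩
    (f ⊛ tail g) n + f (suc n) * g 0                               ∎
    where
    shift : ∀ i → i < suc n → f i * g (suc n ∸ i) ≈ f i * g (suc (n ∸ i))
    shift i i<1+n = *-congˡ (reflexive (≡.cong g (ℕₚ.+-∸-assoc 1 (ℕₚ.≤-pred i<1+n))))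

  ⊛-cong : ∀ {f f′ g g′} → f ≋ f′ → g ≋ g′ → f ⊛ g ≋ f′ ⊛ g′
  ⊛-cong {f} {f′} {g} {g′} f≋f′ g≋g′ j = begin
    (f ⊛ g) j                             ≈⟨ ⊛-∑< f g j ⟩
    ∑< (suc j) (λ i → f i * g (j ∸ i))    ≈⟨ ∑<-cong (suc j) (λ i _ → *-cong (f≋f′ i) (g≋g′ (j ∸ i))) ⟩
    ∑< (suc j) (λ i → f′ i * g′ (j ∸ i))  ≈⟨ sym (⊛-∑< f′ g′ j) ⟩
    (f′ ⊛ g′) j                           ∎

  ⊛-comm : ∀ f g → f ⊛ g ≋ g ⊛ f
  ⊛-comm f g zero    = trans (⊛-zero f g) (trans (*-comm _ _) (sym (⊛-zero g f)))
  ⊛-comm f g (suc n) = begin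
    (f ⊛ g) (suc n)                   ≈⟨ ⊛-suc-head f g n ⟩
    f 0 * g (suc n) + (tail f ⊛ g) n  ≈⟨ +-cong (*-comm _ _) (⊛-comm (tail f) g n) ⟩
    g (suc n) * f 0 + (g ⊛ tail f) n  ≈⟨ +-comm _ _ ⟩
    (g ⊛ tail f) n + g (suc n) * f 0  ≈⟨ sym (⊛-suc-last g f n) ⟩
    (g ⊛ f) (suc n)                   ∎

  ⊛-distribʳ : ∀ f g h → (f ⊕ g) ⊛ h ≋ (f ⊛ h) ⊕ (g ⊛ h)
  ⊛-distribʳ f g h j = begin
    ((f ⊕ g) ⊛ h) j                                                         ≈⟨ ⊛-∑< _ _ j ⟩
    ∑< (suc j) (λ i → (f ⊕ g) i * h (j ∸ i))                                ≈⟨ ∑<-cong (suc j) (λ i _ → trans (*-congʳ (reflexive (⊕-at f g i))) (distribʳ _ _ _)) ⟩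
    ∑< (suc j) (λ i → f i * h (j ∸ i) + g i * h (j ∸ i))                    ≈⟨ ∑<-∙ (suc j) _ _ ⟩
    ∑< (suc j) (λ i → f i * h (j ∸ i)) + ∑< (suc j) (λ i → g i * h (j ∸ i)) ≈⟨ +-cong (sym (⊛-∑< f h j)) (sym (⊛-∑< g h j)) ⟩
    (f ⊛ h) j + (g ⊛ h) j                                                   ≡⟨ ⊕-at (f ⊛ h) (g ⊛ h) j ⟨
    ((f ⊛ h) ⊕ (g ⊛ h)) j                                                   ∎

  ⊛-scale : ∀ a f g → scale a f ⊛ g ≋ scale a (f ⊛ g)
  ⊛-scale a f g j = begin
    (scale a f ⊛ g) j                          ≈⟨ ⊛-∑< _ _ j ⟩
    ∑< (suc j) (λ i → (a * f i) * g (j ∸ i))   ≈⟨ ∑<-cong (suc j) (λ i _ → *-assoc _ _ _) ⟩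
    ∑< (suc j) (λ i → a * (f i * g (j ∸ i)))   ≈⟨ sym (∑<-*ˡ (suc j) a _) ⟩
    a * ∑< (suc j) (λ i → f i * g (j ∸ i))     ≈⟨ *-congˡ (sym (⊛-∑< f g j)) ⟩
    a * (f ⊛ g) j                              ∎

  tail-⊛ : ∀ f g → tail (f ⊛ g) ≋ scale (f 0) (tail g) ⊕ (tail f ⊛ g)
  tail-⊛ f g n = trans (⊛-suc-head f g n) (reflexive (≡.sym (⊕-at _ _ n)))

  ⊛-zeroˡ : ∀ g → 𝟘 ⊛ g ≋ 𝟘
  ⊛-zeroˡ g j = trans (⊛-∑< _ _ j) (∑<-ε (suc j) (λ i _ → zeroˡ _))

  ⊛-identityˡ : ∀ g → 𝟙 ⊛ g ≋ g
  ⊛-identityˡ g zero    = trans (⊛-zero _ _) (*-identityˡ _)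
  ⊛-identityˡ g (suc n) = begin
    (𝟙 ⊛ g) (suc n)               ≈⟨ ⊛-suc-head _ _ n ⟩
    1# * g (suc n) + (𝟘 ⊛ g) n    ≈⟨ +-cong (*-identityˡ _) (⊛-zeroˡ g n) ⟩
    g (suc n) + 0#                ≈⟨ +-identityʳ _ ⟩
    g (suc n)                     ∎

  ⊛-assoc : ∀ f g h → (f ⊛ g) ⊛ h ≋ f ⊛ (g ⊛ h)
  ⊛-assoc f g h zero = begin
    ((f ⊛ g) ⊛ h) 0    ≈⟨ trans (⊛-zero _ _) (*-congʳ (⊛-zero f g)) ⟩
    (f 0 * g 0) * h 0  ≈⟨ *-assoc _ _ _ ⟩
    f 0 * (g 0 * h 0)  ≈⟨ sym (trans (⊛-zero _ _) (*-congˡ (⊛-zero g h))) ⟩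
    (f ⊛ (g ⊛ h)) 0    ∎
  ⊛-assoc f g h (suc n) = begin
    ((f ⊛ g) ⊛ h) (suc n)
      ≈⟨ ⊛-suc-head (f ⊛ g) h n ⟩
    (f ⊛ g) 0 * h (suc n) + (tail (f ⊛ g) ⊛ h) n
      ≈⟨ +-cong (*-congʳ (⊛-zero f g)) (⊛-cong {g = h} (tail-⊛ f g) (λ _ → refl) n) ⟩
    (f 0 * g 0) * h (suc n) + ((scale (f 0) (tail g) ⊕ (tail f ⊛ g)) ⊛ h) n
      ≈⟨ +-congˡ (trans (⊛-distribʳ (scale (f 0) (tail g)) (tail f ⊛ g) h n) (reflexive (⊕-at _ _ n))) ⟩
    (f 0 * g 0) * h (suc n) + ((scale (f 0) (tail g) ⊛ h) n + ((tail f ⊛ g) ⊛ h) n)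
      ≈⟨ +-congˡ (+-cong (⊛-scale (f 0) (tail g) h n) (⊛-assoc (tail f) g h n)) ⟩
    (f 0 * g 0) * h (suc n) + (f 0 * (tail g ⊛ h) n + (tail f ⊛ (g ⊛ h)) n)
      ≈⟨ sym (+-assoc _ _ _) ⟩
    ((f 0 * g 0) * h (suc n) + f 0 * (tail g ⊛ h) n) + (tail f ⊛ (g ⊛ h)) n
      ≈⟨ +-congʳ (trans (+-congʳ (*-assoc _ _ _)) (sym (distribˡ _ _ _))) ⟩
    f 0 * (g 0 * h (suc n) + (tail g ⊛ h) n) + (tail f ⊛ (g ⊛ h)) n
      ≈⟨ +-congʳ (*-congˡ (sym (⊛-suc-head g h n))) ⟩
    f 0 * (g ⊛ h) (suc n) + (tail f ⊛ (g ⊛ h)) n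
      ≈⟨ sym (⊛-suc-head f (g ⊛ h) n) ⟩
    (f ⊛ (g ⊛ h)) (suc n) ∎

  powerSeriesRing : CommutativeRing c ℓ
  powerSeriesRing = record
    { Carrier = Series ; _≈_ = _≋_ ; _+_ = _⊕_ ; _*_ = _⊛_ ; -_ = ⊝_ ; 0# = 𝟘 ; 1# = 𝟙
    ; isCommutativeRing = record
      { isRing = record
        { +-isAbelianGroup = record
          { isGroup = record
            { isMonoid = record
              { isSemigroup = record
                { isMagma = record
                  { isEquivalence = record { refl = λ _ → refl ; sym = λ p j → sym (p j) ; trans = λ p q j → trans (p j) (q j) }
                  ; ∙-cong = ⊕-cong }
                ; assoc = ⊕-assoc }
              ; identity = ⊕-identityˡ , ⊕-identityʳ }
            ; inverse = ⊝-inverseˡ , ⊝-inverseʳ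
            ; ⁻¹-cong = ⊝-cong }
          ; comm = ⊕-comm }
        ; *-cong = ⊛-cong
        ; *-assoc = ⊛-assoc
        ; *-identity = ⊛-identityˡ , (λ f j → trans (⊛-comm f 𝟙 j) (⊛-identityˡ f j))
        ; distrib = (λ f g h j → trans (⊛-comm f (g ⊕ h) j) (trans (⊛-distribʳ g h f j) (⊕-cong (⊛-comm g f) (⊛-comm h f) j)))
                  , (λ f g h → ⊛-distribʳ g h f) }
      ; *-comm = ⊛-comm } }

  module SeriesSum = FiniteSum (CommutativeRing.+-commutativeMonoid powerSeriesRing)

  ∑<-pointwise : ∀ n (t : ℕ → Series) j → SeriesSum.∑< n t j ≡ ∑< n (λ i → t i j)
  ∑<-pointwise zero    t j = ≡.refl
  ∑<-pointwise (suc n) t j = ≡.trans (⊕-at _ _ j) (≡.cong (_+ t n j) (∑<-pointwise n t j))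

  module SeriesProduct = FiniteSum (CommutativeRing.*-commutativeMonoid powerSeriesRing)
  open import Algebra.Properties.Semiring.Exp (CommutativeRing.semiring powerSeriesRing) public using (_^_; ^-congˡ)

  ∏<-at-zero : ∀ n (t : ℕ → Series) → (∀ i → i < n → t i 0 ≈ 1#) → SeriesProduct.∑< n t 0 ≈ 1#
  ∏<-at-zero zero    t t0≈1 = refl
  ∏<-at-zero (suc n) t t0≈1 = begin
    (SeriesProduct.∑< n t ⊛ t n) 0   ≈⟨ ⊛-zero _ _ ⟩
    SeriesProduct.∑< n t 0 * t n 0   ≈⟨ *-cong (∏<-at-zero n t (λ i i<n → t0≈1 i (ℕₚ.m<n⇒m<1+n i<n))) (t0≈1 n ℕₚ.≤-refl) ⟩
    1# * 1#                          ≈⟨ *-identityˡ 1# ⟩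
    1#                               ∎

  ^-at-zero : ∀ f k → f 0 ≈ 1# → (f ^ k) 0 ≈ 1#
  ^-at-zero f zero    f0≈1 = refl
  ^-at-zero f (suc k) f0≈1 = trans (⊛-zero _ _) (trans (*-cong f0≈1 (^-at-zero f k f0≈1)) (*-identityˡ 1#))

  Polynomial : Series → Set ℓ
  Polynomial f = ∃ λ d → ∀ j → d < j → f j ≈ 0#

  polynomial-≋ : ∀ {f g} → f ≋ g → Polynomial f → Polynomial g
  polynomial-≋ f≋g (d , f↑0) = d , λ j d<j → trans (sym (f≋g j)) (f↑0 j d<j)

  polynomial-𝟘 : Polynomial 𝟘
  polynomial-𝟘 = 0 , λ _ _ → refl

  polynomial-𝟙 : Polynomial 𝟙
  polynomial-𝟙 = 0 , λ { (suc j) _ → refl }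

  polynomial-⊕ : ∀ {f g} → Polynomial f → Polynomial g → Polynomial (f ⊕ g)
  polynomial-⊕ {f} {g} (d , f↑0) (e , g↑0) = d ℕ.⊔ e , λ j d⊔e<j →
    trans (reflexive (⊕-at f g j)) (trans (+-cong (f↑0 j (ℕₚ.≤-<-trans (ℕₚ.m≤m⊔n d e) d⊔e<j)) (g↑0 j (ℕₚ.≤-<-trans (ℕₚ.m≤n⊔m d e) d⊔e<j)))
          (+-identityʳ 0#))

  polynomial-⊝ : ∀ {f} → Polynomial f → Polynomial (⊝ f)
  polynomial-⊝ {f} (d , f↑0) = d , λ j d<j → trans (reflexive (⊝-at f j)) (trans (-‿cong (f↑0 j d<j)) ε⁻¹≈ε)
    where
    open import Algebra.Properties.AbelianGroup +-abelianGroup using (ε⁻¹≈ε)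

  -- Beyond degree d + e, every product f i g (j - i) has i > d or j - i > e.
  polynomial-⊛ : ∀ {f g} → Polynomial f → Polynomial g → Polynomial (f ⊛ g)
  polynomial-⊛ {f} {g} (d , f↑0) (e , g↑0) = d ℕ.+ e , λ j d+e<j →
    trans (⊛-∑< f g j) (∑<-ε (suc j) (λ i i<1+j → term-vanishes j d+e<j i (ℕₚ.≤-pred i<1+j)))
    where
    term-vanishes : ∀ j → d ℕ.+ e < j → ∀ i → i ≤ j → f i * g (j ∸ i) ≈ 0#
    term-vanishes j d+e<j i i≤j with d ℕₚ.<? i
    ... | yes d<i = trans (*-congʳ (f↑0 i d<i)) (zeroˡ _)
    ... | no d≮i  = trans (*-congˡ (g↑0 (j ∸ i) e<j∸i)) (zeroʳ _)
      where
      i≤d : i ≤ d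
      i≤d = ℕₚ.≮⇒≥ d≮i
      e<j∸i : e < j ∸ i
      e<j∸i = ℕₚ.+-cancelˡ-< i e (j ∸ i)
        (≡.subst (i ℕ.+ e <_) (≡.sym (ℕₚ.m+[n∸m]≡n i≤j)) (ℕₚ.≤-<-trans (ℕₚ.+-monoˡ-≤ e i≤d) d+e<j))

  polynomial-∑< : ∀ n (t : ℕ → Series) → (∀ i → i < n → Polynomial (t i)) → Polynomial (SeriesSum.∑< n t)
  polynomial-∑< zero    t poly = polynomial-𝟘
  polynomial-∑< (suc n) t poly = polynomial-⊕ (polynomial-∑< n t (λ i i<n → poly i (ℕₚ.m<n⇒m<1+n i<n))) (poly n ℕₚ.≤-refl)

  polynomial-∏< : ∀ n (t : ℕ → Series) → (∀ i → i < n → Polynomial (t i)) → Polynomial (SeriesProduct.∑< n t)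
  polynomial-∏< zero    t poly = polynomial-𝟙
  polynomial-∏< (suc n) t poly = polynomial-⊛ (polynomial-∏< n t (λ i i<n → poly i (ℕₚ.m<n⇒m<1+n i<n))) (poly n ℕₚ.≤-refl)

  AgreeUpTo : ℕ → Series → Series → Set ℓ
  AgreeUpTo N f g = ∀ j → j ≤ N → f j ≈ g j

  ∑<-agree : ∀ {N} n {t u : ℕ → Series} → (∀ i → i < n → AgreeUpTo N (t i) (u i)) → AgreeUpTo N (SeriesSum.∑< n t) (SeriesSum.∑< n u)
  ∑<-agree n {t} {u} t~u j j≤N = begin
    SeriesSum.∑< n t j       ≡⟨ ∑<-pointwise n t j ⟩
    ∑< n (λ i → t i j)       ≈⟨ ∑<-cong n (λ i i<n → t~u i i<n j j≤N) ⟩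
    ∑< n (λ i → u i j)       ≡⟨ ∑<-pointwise n u j ⟨
    SeriesSum.∑< n u j       ∎

  ⊛-agree : ∀ {N f f′ g g′} → AgreeUpTo N f f′ → AgreeUpTo N g g′ → AgreeUpTo N (f ⊛ g) (f′ ⊛ g′)
  ⊛-agree {N} {f} {f′} {g} {g′} f~f′ g~g′ j j≤N = begin
    (f ⊛ g) j                             ≈⟨ ⊛-∑< f g j ⟩
    ∑< (suc j) (λ i → f i * g (j ∸ i))    ≈⟨ ∑<-cong (suc j) termwise ⟩
    ∑< (suc j) (λ i → f′ i * g′ (j ∸ i))  ≈⟨ sym (⊛-∑< f′ g′ j) ⟩
    (f′ ⊛ g′) j                           ∎
    where
    termwise : ∀ i → i < suc j → f i * g (j ∸ i) ≈ f′ i * g′ (j ∸ i)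
    termwise i i<1+j = *-cong (f~f′ i (ℕₚ.≤-trans (ℕₚ.≤-pred i<1+j) j≤N)) (g~g′ (j ∸ i) (ℕₚ.≤-trans (ℕₚ.m∸n≤m j i) j≤N))

module ℤ⟦x⟧ = PowerSeries ℤₚ.+-*-commutativeRing

ℤ⟦x⟧-ring : CommutativeRing 0ℓ 0ℓ
ℤ⟦x⟧-ring = ℤ⟦x⟧.powerSeriesRing

module ℤ⟦x⟧⟦a⟧ = PowerSeries ℤ⟦x⟧-ring

module ℤx = CommutativeRing ℤ⟦x⟧-ring
open ℤx using (_≈_; _+_; _*_; -_; 0#; 1#)
open import Algebra.Properties.Monoid ℤx.*-monoid using (cancelʳ; insertʳ)
open import Algebra.Properties.Ring ℤx.ring using (-‿distribʳ-*)
open import Algebra.Solver.Ring.NaturalCoefficients.Default ℤx.commutativeSemiring using (solve; _:+_; _:*_; _:=_)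
open import Data.Nat.Tactic.RingSolver using (solve-∀)
open import Data.Nat.DivMod using (m*n/n≡m)
open ℤ⟦x⟧ using (Polynomial; polynomial-≋; polynomial-𝟘; polynomial-𝟙; polynomial-⊕; polynomial-⊝; polynomial-⊛)
open ℤ⟦x⟧.SeriesProduct using ()
  renaming (∑< to ∏<; ∑<-cong to ∏<-cong; ∑<-+ to ∏<-+; ∑<-reverse to ∏<-reverse; foldr-map-upTo to foldr-*-map-upTo)
open ℤ⟦x⟧⟦a⟧ using (∑<; ∑<-cong; ∑<-*ʳ)

mulS≈* : ∀ f g → mulS f g ≈ f * g
mulS≈* f g j = ≡.sym (ℤ⟦x⟧.⊛-unfold f g j)

oneS≈1 : oneS ≈ 1#
oneS≈1 zero    = ≡.refl
oneS≈1 (suc j) = ≡.refl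

prodS≈foldr : ∀ fs → prodS fs ≈ foldr _*_ 1# fs
prodS≈foldr []       = oneS≈1
prodS≈foldr (f ∷ fs) = ℤx.trans (mulS≈* f (prodS fs)) (ℤx.*-congˡ (prodS≈foldr fs))

prodS-map-upTo : ∀ n φ → prodS (map φ (upTo n)) ≈ ∏< n φ
prodS-map-upTo n φ = ℤx.trans (prodS≈foldr (map φ (upTo n))) (foldr-*-map-upTo n φ)

xpow-zero : xpow 0 ≈ 1#
xpow-zero zero    = ≡.refl
xpow-zero (suc j) = ≡.refl

*xpow-suc-at-zero : ∀ f e → (f * xpow (suc e)) 0 ≡ 0ℤ
*xpow-suc-at-zero f e = ≡.trans (ℤ⟦x⟧.⊛-zero f (xpow (suc e))) (ℤₚ.*-zeroʳ (f 0))

*xpow-suc-at-suc : ∀ f e n → (f * xpow (suc e)) (suc n) ≡ (f * xpow e) n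
*xpow-suc-at-suc f e n = ≡.trans (ℤ⟦x⟧.⊛-suc-last f (xpow (suc e)) n)
  (≡.trans (≡.cong (λ z → (f * xpow e) n ℤ.+ z) (ℤₚ.*-zeroʳ (f (suc n)))) (ℤₚ.+-identityʳ _))

xpow-+ : ∀ a b → xpow a * xpow b ≈ xpow (a ℕ.+ b)
xpow-+ zero    b j       = ℤx.trans (ℤx.*-congʳ xpow-zero) (ℤx.*-identityˡ (xpow b)) j
xpow-+ (suc a) b zero    = ≡.trans (ℤx.*-comm (xpow (suc a)) (xpow b) 0) (*xpow-suc-at-zero (xpow b) a)
xpow-+ (suc a) b (suc j) = ≡.trans (ℤx.*-comm (xpow (suc a)) (xpow b) (suc j))
  (≡.trans (*xpow-suc-at-suc (xpow b) a j) (≡.trans (ℤx.*-comm (xpow b) (xpow a) j) (xpow-+ a b j)))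

oneMinusX≈ : ∀ e → oneMinusX e ≈ 1# + - xpow e
oneMinusX≈ e j = ≡.sym (≡.trans (ℤ⟦x⟧.⊕-at _ _ j) (≡.cong₂ ℤ._+_ (≡.sym (oneS≈1 j)) (ℤ⟦x⟧.⊝-at _ j)))

module _ (f : Ser) where

  invList-lookup : ∀ j i → i ≤ j → nthOr 0ℤ (invList f j) i ≡ invS f (j ∸ i)
  invList-lookup j       zero    _         = ≡.refl
  invList-lookup (suc j) (suc i) (s≤s i≤j) = invList-lookup j i i≤j

  invS-inverse : f 0 ≡ 1ℤ → f * invS f ≈ 1#
  invS-inverse f0≡1 zero    = ≡.trans (ℤ⟦x⟧.⊛-zero f (invS f)) (≡.cong (ℤ._* 1ℤ) f0≡1)
  invS-inverse f0≡1 (suc j) = begin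
    (f * invS f) (suc j)                                                   ≡⟨ ℤ⟦x⟧.⊛-suc-head f (invS f) j ⟩
    f 0 ℤ.* invS f (suc j) ℤ.+ (ℤ⟦x⟧.tail f * invS f) j                    ≡⟨ ≡.cong₂ ℤ._+_ (≡.trans (≡.cong (ℤ._* invS f (suc j)) f0≡1) (ℤₚ.*-identityˡ _)) (ℤ⟦x⟧.⊛-∑< (ℤ⟦x⟧.tail f) (invS f) j) ⟩
    ℤ.- s ℤ.+ ℤ⟦x⟧.∑< (suc j) (λ i → f (suc i) ℤ.* invS f (j ∸ i))         ≡⟨ ≡.cong (λ z → ℤ.- s ℤ.+ z) (≡.sym s≡∑) ⟩
    ℤ.- s ℤ.+ s                                                            ≡⟨ ℤₚ.+-inverseˡ s ⟩
    0ℤ                                                                     ∎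
    where
    open ≡.≡-Reasoning
    s : ℤ
    s = sumℤ (map (λ i → f (suc i) ℤ.* nthOr 0ℤ (invList f j) i) (upTo (suc j)))
    s≡∑ : s ≡ ℤ⟦x⟧.∑< (suc j) (λ i → f (suc i) ℤ.* invS f (j ∸ i))
    s≡∑ = ≡.trans (ℤ⟦x⟧.foldr-map-upTo (suc j) _)
      (ℤ⟦x⟧.∑<-cong (suc j) (λ i i<1+j → ≡.cong (f (suc i) ℤ.*_) (invList-lookup j i (ℕₚ.≤-pred i<1+j))))

open import Relation.Binary.Reasoning.Setoid ℤx.setoid

xpow+oneMinusX : ∀ e → xpow e + oneMinusX e ≈ 1#
xpow+oneMinusX e = begin
  xpow e + oneMinusX e         ≈⟨ ℤx.+-congˡ (oneMinusX≈ e) ⟩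
  xpow e + (1# + - xpow e)     ≈⟨ ℤx.+-comm _ _ ⟩
  (1# + - xpow e) + xpow e     ≈⟨ ℤx.+-assoc _ _ _ ⟩
  1# + (- xpow e + xpow e)     ≈⟨ ℤx.+-congˡ (ℤx.-‿inverseˡ (xpow e)) ⟩
  1# + 0#                      ≈⟨ ℤx.+-identityʳ 1# ⟩
  1#                           ∎

*-xpow+*-oneMinusX : ∀ f e → f * xpow e + f * oneMinusX e ≈ f
*-xpow+*-oneMinusX f e = ℤx.trans (ℤx.sym (ℤx.distribˡ f _ _)) (ℤx.trans (ℤx.*-congˡ (xpow+oneMinusX e)) (ℤx.*-identityʳ f))

oneMinusX-+ : ∀ a b → oneMinusX a + xpow a * oneMinusX b ≈ oneMinusX (a ℕ.+ b)
oneMinusX-+ a b = begin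
  oneMinusX a + xa * oneMinusX b              ≈⟨ ℤx.+-cong (oneMinusX≈ a) (ℤx.*-congˡ (oneMinusX≈ b)) ⟩
  (1# + - xa) + xa * (1# + - xb)              ≈⟨ ℤx.+-congˡ (ℤx.trans (ℤx.distribˡ xa 1# (- xb)) (ℤx.+-cong (ℤx.*-identityʳ xa) (ℤx.sym (-‿distribʳ-* xa xb)))) ⟩
  (1# + - xa) + (xa + - (xa * xb))            ≈⟨ ℤx.sym (ℤx.+-assoc _ _ _) ⟩
  ((1# + - xa) + xa) + - (xa * xb)            ≈⟨ ℤx.+-congʳ (ℤx.trans (ℤx.+-assoc _ _ _) (ℤx.trans (ℤx.+-congˡ (ℤx.-‿inverseˡ xa)) (ℤx.+-identityʳ 1#))) ⟩
  1# + - (xa * xb)                            ≈⟨ ℤx.+-congˡ (ℤx.-‿cong (xpow-+ a b)) ⟩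
  1# + - xpow (a ℕ.+ b)                       ≈⟨ ℤx.sym (oneMinusX≈ (a ℕ.+ b)) ⟩
  oneMinusX (a ℕ.+ b)                         ∎
  where
  xa xb : Ser
  xa = xpow a
  xb = xpow b

*-cancelʳ-invertible : ∀ {q q′ u v} → q * q′ ≈ 1# → u * q ≈ v * q → u ≈ v
*-cancelʳ-invertible {u = u} {v} qq′≈1 uq≈vq = ℤx.trans (insertʳ qq′≈1 u) (ℤx.trans (ℤx.*-congʳ uq≈vq) (cancelʳ qq′≈1 v))

*-invertible : ∀ {q q′ r r′} → q * q′ ≈ 1# → r * r′ ≈ 1# → (q * r) * (q′ * r′) ≈ 1#
*-invertible {q} {q′} {r} {r′} qq′≈1 rr′≈1 = begin
  (q * r) * (q′ * r′)   ≈⟨ solve 4 (λ q r q′ r′ → (q :* r) :* (q′ :* r′) := (q :* q′) :* (r :* r′)) ℤx.refl q r q′ r′ ⟩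
  (q * q′) * (r * r′)   ≈⟨ ℤx.*-cong qq′≈1 rr′≈1 ⟩
  1# * 1#               ≈⟨ ℤx.*-identityˡ 1# ⟩
  1#                    ∎

-- q-Pochhammer symbols and Gaussian polynomials

poch : ℕ → Ser
poch n = ∏< n (λ i → oneMinusX (suc i))

qpoch≈poch : ∀ n → qpoch n ≈ poch n
qpoch≈poch n = prodS-map-upTo n _

poch-at-zero : ∀ n → poch n 0 ≡ 1ℤ
poch-at-zero n = ℤ⟦x⟧.∏<-at-zero n _ (λ _ _ → ≡.refl)

poch⁻¹ : ℕ → Ser
poch⁻¹ n = invS (qpoch n)

poch-inverse : ∀ n → poch n * poch⁻¹ n ≈ 1#
poch-inverse n = ℤx.trans (ℤx.*-congʳ (ℤx.sym (qpoch≈poch n)))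
  (invS-inverse (qpoch n) (≡.trans (qpoch≈poch n 0) (poch-at-zero n)))

poch²⁻¹ : ℕ → Ser
poch²⁻¹ n = invS (mulS (qpoch n) (qpoch n))

poch²-inverse : ∀ n → (poch n * poch n) * poch²⁻¹ n ≈ 1#
poch²-inverse n = ℤx.trans (ℤx.*-congʳ (ℤx.sym qpoch²≈)) (invS-inverse _ (≡.trans (qpoch²≈ 0) poch²-at-zero))
  where
  qpoch²≈ : mulS (qpoch n) (qpoch n) ≈ poch n * poch n
  qpoch²≈ = ℤx.trans (mulS≈* _ _) (ℤx.*-cong (qpoch≈poch n) (qpoch≈poch n))
  poch²-at-zero : (poch n * poch n) 0 ≡ 1ℤ
  poch²-at-zero = ≡.trans (ℤ⟦x⟧.⊛-zero (poch n) (poch n)) (≡.cong₂ ℤ._*_ (poch-at-zero n) (poch-at-zero n))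

poch⁻¹-zero : poch⁻¹ 0 ≈ 1#
poch⁻¹-zero = ℤx.trans (ℤx.sym (ℤx.*-identityˡ _)) (poch-inverse 0)

poch⁻¹-suc : ∀ n → poch⁻¹ (suc n) * oneMinusX (suc n) ≈ poch⁻¹ n
poch⁻¹-suc n = *-cancelʳ-invertible (poch-inverse n) (begin
  (poch⁻¹ (suc n) * oneMinusX (suc n)) * poch n  ≈⟨ ℤx.*-assoc _ _ _ ⟩
  poch⁻¹ (suc n) * (oneMinusX (suc n) * poch n)  ≈⟨ ℤx.*-congˡ (ℤx.*-comm _ _) ⟩
  poch⁻¹ (suc n) * poch (suc n)                  ≈⟨ ℤx.trans (ℤx.*-comm _ _) (poch-inverse (suc n)) ⟩
  1#                                             ≈⟨ ℤx.trans (ℤx.*-comm _ _) (poch-inverse n) ⟨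
  poch⁻¹ n * poch n                              ∎)

shiftedPoch : ℕ → ℕ → Ser
shiftedPoch a b = ∏< b (λ i → oneMinusX (suc (a ℕ.+ i)))

poch-∸ : ∀ n k → k ≤ n → poch (n ∸ k) * shiftedPoch (n ∸ k) k ≈ poch n
poch-∸ n k k≤n = begin
  poch (n ∸ k) * shiftedPoch (n ∸ k) k   ≈⟨ ℤx.sym (∏<-+ (n ∸ k) k _) ⟩
  poch (n ∸ k ℕ.+ k)                     ≡⟨ ≡.cong poch (ℕₚ.m∸n+n≡m k≤n) ⟩
  poch n                                 ∎

gauss-poch : ∀ n k → gauss n k * poch k ≈ shiftedPoch (n ∸ k) k
gauss-poch n k = begin
  mulS numerator (poch⁻¹ k) * poch k   ≈⟨ ℤx.*-congʳ (mulS≈* _ _) ⟩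
  (numerator * poch⁻¹ k) * poch k      ≈⟨ ℤx.*-assoc _ _ _ ⟩
  numerator * (poch⁻¹ k * poch k)      ≈⟨ ℤx.*-congˡ (ℤx.trans (ℤx.*-comm _ _) (poch-inverse k)) ⟩
  numerator * 1#                       ≈⟨ ℤx.*-identityʳ _ ⟩
  numerator                            ≈⟨ prodS-map-upTo k _ ⟩
  ∏< k (λ i → oneMinusX ((n ∸ k) ℕ.+ suc i))   ≈⟨ ∏<-cong k (λ i _ → ℤx.reflexive (≡.cong oneMinusX (ℕₚ.+-suc (n ∸ k) i))) ⟩
  shiftedPoch (n ∸ k) k                ∎
  where
  numerator : Ser
  numerator = prodS (map (λ i → oneMinusX ((n ∸ k) ℕ.+ suc i)) (upTo k))

-- qBinom a b is the Gaussian polynomial [a + b choose a], built by the q-Pascal rule.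
qBinom : ℕ → ℕ → Ser
qBinom zero    b       = 1#
qBinom (suc a) zero    = 1#
qBinom (suc a) (suc b) = qBinom a (suc b) + xpow (suc a) * qBinom (suc a) b

qBinom-poch : ∀ a b → (qBinom a b * poch a) * poch b ≈ poch (a ℕ.+ b)
qBinom-poch zero    b    = ℤx.trans (ℤx.*-congʳ (ℤx.*-identityˡ 1#)) (ℤx.*-identityˡ (poch b))
qBinom-poch (suc a) zero = begin
  (1# * poch (suc a)) * 1#   ≈⟨ ℤx.trans (ℤx.*-identityʳ _) (ℤx.*-identityˡ _) ⟩
  poch (suc a)               ≡⟨ ≡.cong poch (ℕₚ.+-identityʳ (suc a)) ⟨
  poch (suc a ℕ.+ 0)         ∎
qBinom-poch (suc a) (suc b) = begin
  ((c₁ + xpow (suc a) * c₂) * (poch a * o₁)) * (poch b * o₂)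
    ≈⟨ solve 7 (λ c₁ c₂ x p₁ o₁ p₂ o₂ → ((c₁ :+ x :* c₂) :* (p₁ :* o₁)) :* (p₂ :* o₂)
                := ((c₁ :* p₁) :* (p₂ :* o₂)) :* o₁ :+ x :* (((c₂ :* (p₁ :* o₁)) :* p₂) :* o₂))
         ℤx.refl c₁ c₂ (xpow (suc a)) (poch a) o₁ (poch b) o₂ ⟩
  ((c₁ * poch a) * poch (suc b)) * o₁ + xpow (suc a) * (((c₂ * poch (suc a)) * poch b) * o₂)
    ≈⟨ ℤx.+-cong (ℤx.*-congʳ (qBinom-poch a (suc b))) (ℤx.*-congˡ (ℤx.*-congʳ (qBinom-poch (suc a) b))) ⟩
  poch (a ℕ.+ suc b) * o₁ + xpow (suc a) * (poch (suc a ℕ.+ b) * o₂)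
    ≡⟨ ≡.cong (λ m → poch (a ℕ.+ suc b) * o₁ + xpow (suc a) * (poch m * o₂)) (ℕₚ.+-suc a b) ⟨
  poch (a ℕ.+ suc b) * o₁ + xpow (suc a) * (poch (a ℕ.+ suc b) * o₂)
    ≈⟨ solve 4 (λ p o₁ x o₂ → p :* o₁ :+ x :* (p :* o₂) := p :* (o₁ :+ x :* o₂)) ℤx.refl (poch (a ℕ.+ suc b)) o₁ (xpow (suc a)) o₂ ⟩
  poch (a ℕ.+ suc b) * (o₁ + xpow (suc a) * o₂)
    ≈⟨ ℤx.*-congˡ (oneMinusX-+ (suc a) (suc b)) ⟩
  poch (suc a ℕ.+ suc b) ∎
  where
  c₁ c₂ o₁ o₂ : Ser
  c₁ = qBinom a (suc b)
  c₂ = qBinom (suc a) b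
  o₁ = oneMinusX (suc a)
  o₂ = oneMinusX (suc b)

gauss≈qBinom : ∀ n k → k ≤ n → gauss n k ≈ qBinom k (n ∸ k)
gauss≈qBinom n k k≤n = *-cancelʳ-invertible (*-invertible (poch-inverse k) (poch-inverse (n ∸ k))) (begin
  gauss n k * (poch k * poch (n ∸ k))            ≈⟨ ℤx.sym (ℤx.*-assoc _ _ _) ⟩
  (gauss n k * poch k) * poch (n ∸ k)            ≈⟨ ℤx.*-congʳ (gauss-poch n k) ⟩
  shiftedPoch (n ∸ k) k * poch (n ∸ k)           ≈⟨ ℤx.trans (ℤx.*-comm _ _) (poch-∸ n k k≤n) ⟩
  poch n                                         ≡⟨ ≡.cong poch (ℕₚ.m+[n∸m]≡n k≤n) ⟨
  poch (k ℕ.+ (n ∸ k))                           ≈⟨ ℤx.sym (qBinom-poch k (n ∸ k)) ⟩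
  (qBinom k (n ∸ k) * poch k) * poch (n ∸ k)     ≈⟨ ℤx.*-assoc _ _ _ ⟩
  qBinom k (n ∸ k) * (poch k * poch (n ∸ k))     ∎)

∸-suc-split : ∀ m i t → t < i → i ≤ m → m ∸ t ≡ suc ((m ∸ i) ℕ.+ (i ∸ suc t))
∸-suc-split (suc m) (suc i) zero    (s≤s z≤n) (s≤s i≤m) = ≡.cong suc (≡.sym (ℕₚ.m∸n+n≡m i≤m))
∸-suc-split (suc m) (suc i) (suc t) (s≤s t<i) (s≤s i≤m) = ∸-suc-split m i t t<i i≤m

partProd≈shiftedPoch : ∀ m i → i ≤ m → partProd (suc m) (suc i) ≈ shiftedPoch (m ∸ i) i
partProd≈shiftedPoch m i i≤m = begin
  partProd (suc m) (suc i)                                      ≈⟨ prodS-map-upTo i _ ⟩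
  ∏< i (λ t → oneMinusX (m ∸ t))                                ≈⟨ ∏<-cong i (λ t t<i → ℤx.reflexive (≡.cong oneMinusX (∸-suc-split m i t t<i i≤m))) ⟩
  ∏< i (λ t → oneMinusX (suc ((m ∸ i) ℕ.+ (i ∸ suc t))))        ≈⟨ ∏<-reverse i _ ⟩
  shiftedPoch (m ∸ i) i                                         ∎

-- Polynomiality of h

polynomial-xpow : ∀ e → Polynomial (xpow e)
polynomial-xpow e = e , xpow-vanishes e
  where
  xpow-vanishes : ∀ e j → e < j → xpow e j ≡ 0ℤ
  xpow-vanishes zero    (suc j) _         = ≡.refl
  xpow-vanishes (suc e) (suc j) (s≤s e<j) = xpow-vanishes e j e<j

polynomial-oneMinusX : ∀ e → Polynomial (oneMinusX e)
polynomial-oneMinusX e = polynomial-≋ (ℤx.sym (oneMinusX≈ e)) (polynomial-⊕ polynomial-𝟙 (polynomial-⊝ (polynomial-xpow e)))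

polynomial-mulS : ∀ {f g} → Polynomial f → Polynomial g → Polynomial (mulS f g)
polynomial-mulS f-poly g-poly = polynomial-≋ (ℤx.sym (mulS≈* _ _)) (polynomial-⊛ f-poly g-poly)

polynomial-qBinom : ∀ a b → Polynomial (qBinom a b)
polynomial-qBinom zero    b       = polynomial-𝟙
polynomial-qBinom (suc a) zero    = polynomial-𝟙
polynomial-qBinom (suc a) (suc b) = polynomial-⊕ (polynomial-qBinom a (suc b)) (polynomial-⊛ (polynomial-xpow (suc a)) (polynomial-qBinom (suc a) b))

hList-lookup : ∀ m i → i ≤ m → nthOr zeroS (hList m) i ≡ h (m ∸ i)
hList-lookup m       zero    _         = ≡.refl
hList-lookup (suc m) (suc i) (s≤s i≤m) = hList-lookup m i i≤m

hTerm : ℕ → ℕ → Ser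
hTerm m i = mulS (mulS (mulS (gauss (suc m) (suc i)) (partProd (suc m) (suc i))) (nthOr zeroS (hList m) i)) (xpow (expo (suc m) (suc i)))

h-suc : ∀ m → h (suc m) ≈ ∑< (suc m) (hTerm m)
h-suc m j = ≡.trans (ℤ⟦x⟧.foldr-map-upTo (suc m) (λ i → hTerm m i j)) (≡.sym (ℤ⟦x⟧.∑<-pointwise (suc m) (hTerm m) j))

hTerm≈ : ∀ m i → i ≤ m → hTerm m i ≈ ((gauss (suc m) (suc i) * partProd (suc m) (suc i)) * h (m ∸ i)) * xpow (expo (suc m) (suc i))
hTerm≈ m i i≤m = ℤx.trans (mulS≈* _ _) (ℤx.*-congʳ
  (ℤx.trans (mulS≈* _ _) (ℤx.*-cong (mulS≈* _ _) (ℤx.reflexive (hList-lookup m i i≤m)))))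

hList-polynomial : ∀ m i → Polynomial (nthOr zeroS (hList m) i)
hList-polynomial zero    zero    = polynomial-≋ (ℤx.sym oneS≈1) polynomial-𝟙
hList-polynomial zero    (suc i) = polynomial-𝟘
hList-polynomial (suc m) zero    = polynomial-≋ (ℤx.sym (h-suc m)) (ℤ⟦x⟧.polynomial-∑< (suc m) (hTerm m) hTerm-polynomial)
  where
  hTerm-polynomial : ∀ i → i < suc m → Polynomial (hTerm m i)
  hTerm-polynomial i (s≤s i≤m) =
    polynomial-mulS (polynomial-mulS (polynomial-mulS
      (polynomial-≋ (ℤx.sym (gauss≈qBinom (suc m) (suc i) (s≤s i≤m))) (polynomial-qBinom (suc i) (m ∸ i)))
      (polynomial-≋ (ℤx.sym (partProd≈shiftedPoch m i i≤m)) (ℤ⟦x⟧.polynomial-∏< i _ (λ t _ → polynomial-oneMinusX (suc (m ∸ i ℕ.+ t))))))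
      (hList-polynomial m i))
      (polynomial-xpow (expo (suc m) (suc i)))
hList-polynomial (suc m) (suc i) = hList-polynomial m i

h-polynomial : ∀ n → Polynomial (h n)
h-polynomial n = hList-polynomial n 0

-- The coefficients of E and F

triangle : ℕ → ℕ
triangle zero    = 0
triangle (suc k) = suc k ℕ.+ triangle k

triangle-half : ∀ i → (suc i ℕ.* i) ℕ./ 2 ≡ triangle i
triangle-half i = ≡.trans (≡.cong (ℕ._/ 2) (≡.sym (triangle-*2 i))) (m*n/n≡m (triangle i) 2)
  where
  regroup : ∀ i → suc i ℕ.* 2 ℕ.+ suc i ℕ.* i ≡ suc (suc i) ℕ.* suc i
  regroup = solve-∀
  triangle-*2 : ∀ i → triangle i ℕ.* 2 ≡ suc i ℕ.* i
  triangle-*2 zero    = ≡.refl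
  triangle-*2 (suc i) = ≡.trans (ℕₚ.*-distribʳ-+ 2 (suc i) (triangle i))
    (≡.trans (≡.cong (suc i ℕ.* 2 ℕ.+_) (triangle-*2 i)) (regroup i))

expo-triangle : ∀ m i → i ≤ m → triangle (suc i) ℕ.+ (m ∸ i) ℕ.+ (m ∸ i) ≡ expo (suc m) (suc i) ℕ.+ suc m
expo-triangle m i i≤m = ≡.trans (regroup (m ∸ i) i (triangle i))
  (≡.cong₂ (λ t s → (m ∸ i) ℕ.+ t ℕ.+ suc s) (≡.sym (triangle-half i)) (ℕₚ.m∸n+n≡m i≤m))
  where
  regroup : ∀ r i t → suc i ℕ.+ t ℕ.+ r ℕ.+ r ≡ r ℕ.+ t ℕ.+ suc (r ℕ.+ i)
  regroup = solve-∀

eulerCoeff : ℕ → Ser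
eulerCoeff k = xpow (triangle k) * poch⁻¹ k

rhsCoeff : ℕ → Ser
rhsCoeff n = (h n * xpow n) * poch²⁻¹ n

poch-gauss-split : ∀ m i → i ≤ m → poch (suc m) ≈ poch (m ∸ i) * (gauss (suc m) (suc i) * poch (suc i))
poch-gauss-split m i i≤m = ℤx.sym (ℤx.trans (ℤx.*-congˡ (gauss-poch (suc m) (suc i))) (poch-∸ (suc m) (suc i) (s≤s i≤m)))

poch-partProd-split : ∀ m i → i ≤ m → poch m ≈ poch (m ∸ i) * partProd (suc m) (suc i)
poch-partProd-split m i i≤m = ℤx.sym (ℤx.trans (ℤx.*-congˡ (partProd≈shiftedPoch m i i≤m)) (poch-∸ m i i≤m))

hTerm-rhsCoeff : ∀ m i → i ≤ m →
  ((eulerCoeff (suc i) * xpow (m ∸ i)) * rhsCoeff (m ∸ i)) * (poch (suc m) * poch m) ≈ hTerm m i * xpow (suc m)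
hTerm-rhsCoeff m i i≤m = begin
  ((xpow (triangle k) * poch⁻¹ k * xr) * ((h r * xr) * poch²⁻¹ r)) * (poch n * poch m)
    ≈⟨ ℤx.*-congˡ (ℤx.*-cong (poch-gauss-split m i i≤m) (poch-partProd-split m i i≤m)) ⟩
  ((xpow (triangle k) * poch⁻¹ k * xr) * ((h r * xr) * poch²⁻¹ r)) * ((poch r * (G * poch k)) * (poch r * P))
    ≈⟨ solve 9 (λ xT q⁻¹ xr hr p²⁻¹ pr G q P →
                  ((xT :* q⁻¹ :* xr) :* ((hr :* xr) :* p²⁻¹)) :* ((pr :* (G :* q)) :* (pr :* P))
               := (((xT :* xr) :* xr) :* ((G :* P) :* hr)) :* ((q :* q⁻¹) :* ((pr :* pr) :* p²⁻¹)))
         ℤx.refl (xpow (triangle k)) (poch⁻¹ k) xr (h r) (poch²⁻¹ r) (poch r) G (poch k) P ⟩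
  (((xpow (triangle k) * xr) * xr) * ((G * P) * h r)) * ((poch k * poch⁻¹ k) * ((poch r * poch r) * poch²⁻¹ r))
    ≈⟨ ℤx.*-congˡ (ℤx.trans (ℤx.*-cong (poch-inverse k) (poch²-inverse r)) (ℤx.*-identityˡ 1#)) ⟩
  (((xpow (triangle k) * xr) * xr) * ((G * P) * h r)) * 1#
    ≈⟨ ℤx.*-identityʳ _ ⟩
  ((xpow (triangle k) * xr) * xr) * ((G * P) * h r)
    ≈⟨ ℤx.*-congʳ (ℤx.trans (ℤx.*-congʳ (xpow-+ (triangle k) r)) (xpow-+ (triangle k ℕ.+ r) r)) ⟩
  xpow (triangle k ℕ.+ r ℕ.+ r) * ((G * P) * h r)
    ≡⟨ ≡.cong (λ e → xpow e * ((G * P) * h r)) (expo-triangle m i i≤m) ⟩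
  xpow (expo n k ℕ.+ n) * ((G * P) * h r)
    ≈⟨ ℤx.*-comm _ _ ⟩
  ((G * P) * h r) * xpow (expo n k ℕ.+ n)
    ≈⟨ ℤx.*-congˡ (ℤx.sym (xpow-+ (expo n k) n)) ⟩
  ((G * P) * h r) * (xpow (expo n k) * xpow n)
    ≈⟨ ℤx.sym (ℤx.*-assoc _ _ _) ⟩
  (((G * P) * h r) * xpow (expo n k)) * xpow n
    ≈⟨ ℤx.*-congʳ (ℤx.sym (hTerm≈ m i i≤m)) ⟩
  hTerm m i * xpow n ∎
  where
  n k r : ℕ
  n = suc m
  k = suc i
  r = m ∸ i
  xr G P : Ser
  xr = xpow r
  G = gauss n k
  P = partProd n k

rhsCoeff-oneMinusX : ∀ m → (rhsCoeff (suc m) * oneMinusX (suc m)) * (poch (suc m) * poch m) ≈ h (suc m) * xpow (suc m)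
rhsCoeff-oneMinusX m = begin
  (((h n * xpow n) * poch²⁻¹ n) * oneMinusX n) * (poch n * poch m)
    ≈⟨ solve 5 (λ hx p²⁻¹ o pn pm → ((hx :* p²⁻¹) :* o) :* (pn :* pm) := hx :* ((pn :* (pm :* o)) :* p²⁻¹))
         ℤx.refl (h n * xpow n) (poch²⁻¹ n) (oneMinusX n) (poch n) (poch m) ⟩
  (h n * xpow n) * ((poch n * poch n) * poch²⁻¹ n)
    ≈⟨ ℤx.*-congˡ (poch²-inverse n) ⟩
  (h n * xpow n) * 1#
    ≈⟨ ℤx.*-identityʳ _ ⟩
  h n * xpow n ∎
  where
  n : ℕ
  n = suc m

-- Clearing the unit (x;x)_(m+1) (x;x)_m turns this into the defining recurrence of h (m + 1).
rhsCoeff-recurrence : ∀ m → rhsCoeff (suc m) * oneMinusX (suc m) ≈ ∑< (suc m) (λ i → (eulerCoeff (suc i) * xpow (m ∸ i)) * rhsCoeff (m ∸ i))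
rhsCoeff-recurrence m = *-cancelʳ-invertible (*-invertible (poch-inverse n) (poch-inverse m)) (begin
  (rhsCoeff n * oneMinusX n) * U                         ≈⟨ rhsCoeff-oneMinusX m ⟩
  h n * xpow n                                           ≈⟨ ℤx.*-congʳ (h-suc m) ⟩
  ∑< n (hTerm m) * xpow n                                ≈⟨ ∑<-*ʳ n (hTerm m) (xpow n) ⟩
  ∑< n (λ i → hTerm m i * xpow n)                        ≈⟨ ∑<-cong n (λ i i<n → hTerm-rhsCoeff m i (ℕₚ.≤-pred i<n)) ⟨
  ∑< n (λ i → summand i * U)                             ≈⟨ ∑<-*ʳ n summand U ⟨
  ∑< n summand * U                                       ∎)
  where
  n : ℕ
  n = suc m
  U : Ser
  U = poch n * poch m
  summand : ℕ → Ser
  summand i = (eulerCoeff (suc i) * xpow (m ∸ i)) * rhsCoeff (m ∸ i)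

ℤ⟦x⟧⟦a⟧-ring : CommutativeRing 0ℓ 0ℓ
ℤ⟦x⟧⟦a⟧-ring = ℤ⟦x⟧⟦a⟧.powerSeriesRing

module ℤxa = CommutativeRing ℤ⟦x⟧⟦a⟧-ring
open ℤxa using () renaming (_≈_ to _≈₂_; _*_ to _⋆_)
open ℤ⟦x⟧⟦a⟧ using (_^_; 𝟙; tail; ⊛-zero; ⊛-suc-head)
open ℤ⟦x⟧⟦a⟧.SeriesProduct using () renaming (∑< to ∏₂<; ∑<-cong to ∏₂<-cong; ∑<-suc-head to ∏₂<-suc-head; ∑<-∙ to ∏₂<-⋆)

mulS2≈⋆ : ∀ F G → mulS2 F G ≈₂ F ⋆ G
mulS2≈⋆ F G i = begin
  mulS2 F G i                              ≈⟨ sum-pointwise ⟩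
  ∑< (suc i) (λ l → mulS (F l) (G (i ∸ l))) ≈⟨ ∑<-cong (suc i) (λ l _ → mulS≈* (F l) (G (i ∸ l))) ⟩
  ∑< (suc i) (λ l → F l * G (i ∸ l))       ≈⟨ ℤ⟦x⟧⟦a⟧.⊛-∑< F G i ⟨
  (F ⋆ G) i                                ∎
  where
  sum-pointwise : mulS2 F G i ≈ ∑< (suc i) (λ l → mulS (F l) (G (i ∸ l)))
  sum-pointwise j = ≡.trans (ℤ⟦x⟧.foldr-map-upTo (suc i) _) (≡.sym (ℤ⟦x⟧.∑<-pointwise (suc i) _ j))

oneS2≈𝟙 : oneS2 ≈₂ 𝟙
oneS2≈𝟙 zero    = oneS≈1
oneS2≈𝟙 (suc i) = ℤx.refl

powS2≈^ : ∀ F k → powS2 F k ≈₂ F ^ k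
powS2≈^ F zero    = oneS2≈𝟙
powS2≈^ F (suc k) = ℤxa.trans (mulS2≈⋆ F (powS2 F k)) (ℤxa.*-congˡ (powS2≈^ F k))

finiteProd : ℕ → Ser2
finiteProd M = ∏₂< M (λ i → linFactor (suc i) ^ suc i)

eulerProd : ℕ → Ser2
eulerProd M = ∏₂< M (λ i → linFactor (suc i))

prodUpTo≈finiteProd : ∀ M → prodUpTo M ≈₂ finiteProd M
prodUpTo≈finiteProd M = ℤxa.trans (foldr≈ (upTo M)) (ℤ⟦x⟧⟦a⟧.SeriesProduct.foldr-map-upTo M _)
  where
  foldr≈ : ∀ ms → foldr (λ i acc → mulS2 (powS2 (linFactor (suc i)) (suc i)) acc) oneS2 ms
               ≈₂ foldr _⋆_ 𝟙 (map (λ i → linFactor (suc i) ^ suc i) ms)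
  foldr≈ []       = oneS2≈𝟙
  foldr≈ (m ∷ ms) = ℤxa.trans (mulS2≈⋆ _ _) (ℤxa.*-cong (powS2≈^ (linFactor (suc m)) (suc m)) (foldr≈ ms))

-- F(a) ↦ F(a x)
dilate : Ser2 → Ser2
dilate F i = F i * xpow i

dilate-zero : ∀ F → dilate F 0 ≈ F 0
dilate-zero F = ℤx.trans (ℤx.*-congˡ xpow-zero) (ℤx.*-identityʳ (F 0))

dilate-⋆ : ∀ F G → dilate (F ⋆ G) ≈₂ dilate F ⋆ dilate G
dilate-⋆ F G i = begin
  (F ⋆ G) i * xpow i                                   ≈⟨ ℤx.*-congʳ (ℤ⟦x⟧⟦a⟧.⊛-∑< F G i) ⟩
  ∑< (suc i) (λ l → F l * G (i ∸ l)) * xpow i          ≈⟨ ∑<-*ʳ (suc i) _ (xpow i) ⟩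
  ∑< (suc i) (λ l → (F l * G (i ∸ l)) * xpow i)        ≈⟨ ∑<-cong (suc i) (λ l l<1+i → split l (ℕₚ.≤-pred l<1+i)) ⟩
  ∑< (suc i) (λ l → dilate F l * dilate G (i ∸ l))     ≈⟨ ℤ⟦x⟧⟦a⟧.⊛-∑< (dilate F) (dilate G) i ⟨
  (dilate F ⋆ dilate G) i                              ∎
  where
  split : ∀ l → l ≤ i → (F l * G (i ∸ l)) * xpow i ≈ dilate F l * dilate G (i ∸ l)
  split l l≤i = begin
    (F l * G (i ∸ l)) * xpow i                      ≡⟨ ≡.cong (λ e → (F l * G (i ∸ l)) * xpow e) (ℕₚ.m+[n∸m]≡n l≤i) ⟨
    (F l * G (i ∸ l)) * xpow (l ℕ.+ (i ∸ l))        ≈⟨ ℤx.*-congˡ (xpow-+ l (i ∸ l)) ⟨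
    (F l * G (i ∸ l)) * (xpow l * xpow (i ∸ l))     ≈⟨ solve 4 (λ f g x y → (f :* g) :* (x :* y) := (f :* x) :* (g :* y)) ℤx.refl (F l) (G (i ∸ l)) (xpow l) (xpow (i ∸ l)) ⟩
    (F l * xpow l) * (G (i ∸ l) * xpow (i ∸ l))     ∎

dilate-𝟙 : dilate 𝟙 ≈₂ 𝟙
dilate-𝟙 zero    = ℤx.trans (ℤx.*-identityˡ (xpow 0)) xpow-zero
dilate-𝟙 (suc i) = ℤx.zeroˡ (xpow (suc i))

dilate-^ : ∀ F k → dilate (F ^ k) ≈₂ dilate F ^ k
dilate-^ F zero    = dilate-𝟙
dilate-^ F (suc k) = ℤxa.trans (dilate-⋆ F (F ^ k)) (ℤxa.*-congˡ (dilate-^ F k))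

dilate-∏₂< : ∀ M (Fs : ℕ → Ser2) → dilate (∏₂< M Fs) ≈₂ ∏₂< M (dilate ∘ Fs)
dilate-∏₂< zero    Fs = dilate-𝟙
dilate-∏₂< (suc M) Fs = ℤxa.trans (dilate-⋆ (∏₂< M Fs) (Fs M)) (ℤxa.*-congʳ (dilate-∏₂< M Fs))

dilate-linFactor : ∀ m → dilate (linFactor m) ≈₂ linFactor (suc m)
dilate-linFactor m zero          = ℤx.trans (ℤx.*-cong oneS≈1 xpow-zero) (ℤx.trans (ℤx.*-identityˡ 1#) (ℤx.sym oneS≈1))
dilate-linFactor m (suc zero)    = ℤx.trans (xpow-+ m 1) (ℤx.reflexive (≡.cong xpow (ℕₚ.+-comm m 1)))
dilate-linFactor m (suc (suc i)) = ℤx.zeroˡ (xpow (suc (suc i)))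

linFactor-⋆-zero : ∀ m G → (linFactor m ⋆ G) 0 ≈ G 0
linFactor-⋆-zero m G = ℤx.trans (⊛-zero (linFactor m) G) (ℤx.trans (ℤx.*-congʳ oneS≈1) (ℤx.*-identityˡ (G 0)))

linFactor-⋆-suc : ∀ m G n → (linFactor m ⋆ G) (suc n) ≈ G (suc n) + xpow m * G n
linFactor-⋆-suc m G n = ℤx.trans (⊛-suc-head (linFactor m) G n)
  (ℤx.+-cong (ℤx.trans (ℤx.*-congʳ oneS≈1) (ℤx.*-identityˡ _)) (tail-linFactor-⋆ n))
  where
  tail-linFactor-⋆ : ∀ n → (tail (linFactor m) ⋆ G) n ≈ xpow m * G n
  tail-linFactor-⋆ zero    = ⊛-zero (tail (linFactor m)) G
  tail-linFactor-⋆ (suc n) = begin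
    (tail (linFactor m) ⋆ G) (suc n)                           ≈⟨ ⊛-suc-head (tail (linFactor m)) G n ⟩
    xpow m * G (suc n) + (tail (tail (linFactor m)) ⋆ G) n     ≈⟨ ℤx.+-congˡ (ℤ⟦x⟧⟦a⟧.⊛-zeroˡ G n) ⟩
    xpow m * G (suc n) + 0#                                    ≈⟨ ℤx.+-identityʳ _ ⟩
    xpow m * G (suc n)                                         ∎

-- The functional equations E(a) = (1 + a x) E(a x) and F(a) = E(a) F(a x)

eulerCoeff-zero : eulerCoeff 0 ≈ 1#
eulerCoeff-zero = ℤx.trans (ℤx.*-cong xpow-zero poch⁻¹-zero) (ℤx.*-identityˡ 1#)

eulerCoeff-suc : ∀ n → eulerCoeff (suc n) * oneMinusX (suc n) ≈ xpow 1 * (eulerCoeff n * xpow n)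
eulerCoeff-suc n = begin
  (xpow (suc n ℕ.+ triangle n) * poch⁻¹ (suc n)) * oneMinusX (suc n)  ≈⟨ ℤx.*-assoc _ _ _ ⟩
  xpow (suc n ℕ.+ triangle n) * (poch⁻¹ (suc n) * oneMinusX (suc n))  ≈⟨ ℤx.*-cong (ℤx.sym (xpow-+ (suc n) (triangle n))) (poch⁻¹-suc n) ⟩
  (xpow (suc n) * xpow (triangle n)) * poch⁻¹ n                       ≈⟨ ℤx.*-congʳ (ℤx.*-congʳ (ℤx.sym (xpow-+ 1 n))) ⟩
  ((xpow 1 * xpow n) * xpow (triangle n)) * poch⁻¹ n                  ≈⟨ solve 4 (λ x₁ xₙ x_T q → ((x₁ :* xₙ) :* x_T) :* q := x₁ :* ((x_T :* q) :* xₙ))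
                                                                           ℤx.refl (xpow 1) (xpow n) (xpow (triangle n)) (poch⁻¹ n) ⟩
  xpow 1 * (eulerCoeff n * xpow n)                                    ∎

rhsCoeff-zero : rhsCoeff 0 ≈ 1#
rhsCoeff-zero = ℤx.trans (ℤx.*-cong (ℤx.trans (ℤx.*-cong oneS≈1 xpow-zero) (ℤx.*-identityˡ 1#)) poch²⁻¹-zero) (ℤx.*-identityˡ 1#)
  where
  poch²⁻¹-zero : poch²⁻¹ 0 ≈ 1#
  poch²⁻¹-zero = ℤx.trans (ℤx.sym (ℤx.trans (ℤx.*-congʳ (ℤx.*-identityˡ 1#)) (ℤx.*-identityˡ _))) (poch²-inverse 0)

eulerCoeff-functional : eulerCoeff ≈₂ linFactor 1 ⋆ dilate eulerCoeff
eulerCoeff-functional zero    = ℤx.sym (ℤx.trans (linFactor-⋆-zero 1 _) (dilate-zero eulerCoeff))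
eulerCoeff-functional (suc n) = ℤx.sym (begin
  (linFactor 1 ⋆ dilate eulerCoeff) (suc n)                                       ≈⟨ linFactor-⋆-suc 1 _ n ⟩
  eulerCoeff (suc n) * xpow (suc n) + xpow 1 * (eulerCoeff n * xpow n)            ≈⟨ ℤx.+-congˡ (eulerCoeff-suc n) ⟨
  eulerCoeff (suc n) * xpow (suc n) + eulerCoeff (suc n) * oneMinusX (suc n)      ≈⟨ *-xpow+*-oneMinusX _ (suc n) ⟩
  eulerCoeff (suc n)                                                              ∎)

rhsCoeff-functional : rhsCoeff ≈₂ eulerCoeff ⋆ dilate rhsCoeff
rhsCoeff-functional zero    = ℤx.sym (begin
  (eulerCoeff ⋆ dilate rhsCoeff) 0      ≈⟨ ⊛-zero eulerCoeff (dilate rhsCoeff) ⟩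
  eulerCoeff 0 * dilate rhsCoeff 0      ≈⟨ ℤx.*-cong eulerCoeff-zero (dilate-zero rhsCoeff) ⟩
  1# * rhsCoeff 0                       ≈⟨ ℤx.*-identityˡ _ ⟩
  rhsCoeff 0                            ∎)
rhsCoeff-functional (suc m) = ℤx.sym (begin
  (eulerCoeff ⋆ dilate rhsCoeff) (suc m)
    ≈⟨ ⊛-suc-head eulerCoeff (dilate rhsCoeff) m ⟩
  eulerCoeff 0 * dilate rhsCoeff n + (tail eulerCoeff ⋆ dilate rhsCoeff) m
    ≈⟨ ℤx.+-cong (ℤx.trans (ℤx.*-congʳ eulerCoeff-zero) (ℤx.*-identityˡ _)) (ℤ⟦x⟧⟦a⟧.⊛-∑< (tail eulerCoeff) (dilate rhsCoeff) m) ⟩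
  rhsCoeff n * xpow n + ∑< n (λ i → eulerCoeff (suc i) * (rhsCoeff (m ∸ i) * xpow (m ∸ i)))
    ≈⟨ ℤx.+-congˡ (∑<-cong n (λ i _ → reorder (eulerCoeff (suc i)) (rhsCoeff (m ∸ i)) (xpow (m ∸ i)))) ⟩
  rhsCoeff n * xpow n + ∑< n (λ i → (eulerCoeff (suc i) * xpow (m ∸ i)) * rhsCoeff (m ∸ i))
    ≈⟨ ℤx.+-congˡ (rhsCoeff-recurrence m) ⟨
  rhsCoeff n * xpow n + rhsCoeff n * oneMinusX n
    ≈⟨ *-xpow+*-oneMinusX _ n ⟩
  rhsCoeff n ∎)
  where
  n : ℕ
  n = suc m
  reorder : ∀ e f x → e * (f * x) ≈ (e * x) * f
  reorder = solve 3 (λ e f x → e :* (f :* x) := (e :* x) :* f) ℤx.refl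

-- Finite products and their agreement with E and F

eulerProd-suc : ∀ M → eulerProd (suc M) ≈₂ linFactor 1 ⋆ dilate (eulerProd M)
eulerProd-suc M = ℤxa.trans (∏₂<-suc-head M (λ i → linFactor (suc i)))
  (ℤxa.*-congˡ (ℤxa.sym (ℤxa.trans (dilate-∏₂< M _) (∏₂<-cong M (λ i _ → dilate-linFactor (suc i))))))

finiteProd-suc : ∀ M → finiteProd (suc M) ≈₂ eulerProd (suc M) ⋆ dilate (finiteProd M)
finiteProd-suc M =
  ℤxa.trans (∏₂<-suc-head M (λ i → linFactor (suc i) ^ suc i))
  (ℤxa.trans (ℤxa.*-cong (ℤxa.*-identityʳ (linFactor 1)) (∏₂<-⋆ M L (λ i → L i ^ suc i)))
  (ℤxa.trans (ℤxa.sym (ℤxa.*-assoc (linFactor 1) (∏₂< M L) _))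
  (ℤxa.*-cong (ℤxa.sym (∏₂<-suc-head M (λ i → linFactor (suc i)))) (ℤxa.sym dilate-finiteProd))))
  where
  L : ℕ → Ser2
  L i = linFactor (suc (suc i))
  dilate-finiteProd : dilate (finiteProd M) ≈₂ ∏₂< M (λ i → L i ^ suc i)
  dilate-finiteProd = ℤxa.trans (dilate-∏₂< M _)
    (∏₂<-cong M (λ i _ → ℤxa.trans (dilate-^ (linFactor (suc i)) (suc i)) (ℤ⟦x⟧⟦a⟧.^-congˡ (suc i) (dilate-linFactor (suc i)))))

Agree₂ : ℕ → Ser2 → Ser2 → Set
Agree₂ N F G = ∀ i → ℤ⟦x⟧.AgreeUpTo N (F i) (G i)

⋆-agree : ∀ {N F F′ G G′} → Agree₂ N F F′ → Agree₂ N G G′ → Agree₂ N (F ⋆ G) (F′ ⋆ G′)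
⋆-agree {F = F} {F′} {G} {G′} F~F′ G~G′ i j j≤N =
  ≡.trans (ℤ⟦x⟧⟦a⟧.⊛-∑< F G i j)
  (≡.trans (ℤ⟦x⟧.∑<-agree (suc i) (λ l _ → ℤ⟦x⟧.⊛-agree (F~F′ l) (G~G′ (i ∸ l))) j j≤N)
  (≡.sym (ℤ⟦x⟧⟦a⟧.⊛-∑< F′ G′ i j)))

*xpow-suc-agree : ∀ {N f g} e → ℤ⟦x⟧.AgreeUpTo N f g → ℤ⟦x⟧.AgreeUpTo (suc N) (f * xpow (suc e)) (g * xpow (suc e))
*xpow-suc-agree {f = f} {g} e f~g zero    _         = ≡.trans (*xpow-suc-at-zero f e) (≡.sym (*xpow-suc-at-zero g e))
*xpow-suc-agree {f = f} {g} e f~g (suc j) (s≤s j≤N) =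
  ≡.trans (*xpow-suc-at-suc f e j) (≡.trans (ℤ⟦x⟧.⊛-agree f~g (λ _ _ → ≡.refl) j j≤N) (≡.sym (*xpow-suc-at-suc g e j)))

dilate-agree : ∀ {N F G} → F 0 ≈ G 0 → Agree₂ N F G → Agree₂ (suc N) (dilate F) (dilate G)
dilate-agree F₀≈G₀ F~G zero    j _ = ℤx.*-congʳ F₀≈G₀ j
dilate-agree F₀≈G₀ F~G (suc e)     = *xpow-suc-agree e (F~G (suc e))

-- Multiplying by a factor that agrees up to x-degree M and then dilating gains one
-- more correct x-degree, since dilation multiplies every positive power of a by
-- a positive power of x.
approximants-agree : ∀ {A : ℕ → Ser2} {A∞ : Ser2} {X : ℕ → Ser2} {X∞ : Ser2} →
  (∀ M → Agree₂ M (A M) A∞) →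
  (∀ M → X (suc M) ≈₂ A (suc M) ⋆ dilate (X M)) →
  X∞ ≈₂ A∞ ⋆ dilate X∞ →
  (∀ M → X M 0 ≈ X∞ 0) →
  Agree₂ 0 (X 0) X∞ →
  ∀ M → Agree₂ M (X M) X∞
approximants-agree A~A∞ X-suc X∞-eq X₀≈ X~X∞ zero    = X~X∞
approximants-agree A~A∞ X-suc X∞-eq X₀≈ X~X∞ (suc M) i j j≤1+M =
  ≡.trans (X-suc M i j)
  (≡.trans (⋆-agree (A~A∞ (suc M)) (dilate-agree (X₀≈ M) (approximants-agree A~A∞ X-suc X∞-eq X₀≈ X~X∞ M)) i j j≤1+M)
  (≡.sym (X∞-eq i j)))

𝟙-agree₀ : ∀ {F} → F 0 0 ≡ 1ℤ → (∀ k → F (suc k) 0 ≡ 0ℤ) → Agree₂ 0 𝟙 F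
𝟙-agree₀ F₀₀≡1 F₊₀≡0 zero    zero z≤n = ≡.sym F₀₀≡1
𝟙-agree₀ F₀₀≡1 F₊₀≡0 (suc k) zero z≤n = ≡.sym (F₊₀≡0 k)

eulerCoeff-suc-at-zero : ∀ k → eulerCoeff (suc k) 0 ≡ 0ℤ
eulerCoeff-suc-at-zero k = ≡.trans (ℤ⟦x⟧.⊛-zero _ _) (ℤₚ.*-zeroˡ (poch⁻¹ (suc k) 0))

rhsCoeff-suc-at-zero : ∀ k → rhsCoeff (suc k) 0 ≡ 0ℤ
rhsCoeff-suc-at-zero k = ≡.trans (ℤ⟦x⟧.⊛-zero _ _)
  (≡.trans (≡.cong (ℤ._* poch²⁻¹ (suc k) 0) (*xpow-suc-at-zero (h (suc k)) k)) (ℤₚ.*-zeroˡ (poch²⁻¹ (suc k) 0)))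

eulerProd-agree : ∀ M → Agree₂ M (eulerProd M) eulerCoeff
eulerProd-agree = approximants-agree (λ _ _ _ _ → ≡.refl) eulerProd-suc eulerCoeff-functional
  (λ M → ℤx.trans (ℤ⟦x⟧⟦a⟧.∏<-at-zero M _ (λ _ _ → oneS≈1)) (ℤx.sym eulerCoeff-zero))
  (𝟙-agree₀ {eulerCoeff} (eulerCoeff-zero 0) eulerCoeff-suc-at-zero)

finiteProd-agree : ∀ M → Agree₂ M (finiteProd M) rhsCoeff
finiteProd-agree = approximants-agree eulerProd-agree finiteProd-suc rhsCoeff-functional
  (λ M → ℤx.trans (ℤ⟦x⟧⟦a⟧.∏<-at-zero M _ (λ i _ → ℤ⟦x⟧⟦a⟧.^-at-zero _ (suc i) oneS≈1)) (ℤx.sym rhsCoeff-zero))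
  (𝟙-agree₀ {rhsCoeff} (rhsCoeff-zero 0) rhsCoeff-suc-at-zero)

rhsSeries≈rhsCoeff : rhsSeries ≈₂ rhsCoeff
rhsSeries≈rhsCoeff zero    = ℤx.trans oneS≈1 (ℤx.sym rhsCoeff-zero)
rhsSeries≈rhsCoeff (suc m) = ℤx.trans (mulS≈* _ _) (ℤx.*-congʳ (mulS≈* _ _))

mainTheorem2 : ((n : ℕ) → ∃ λ d → (j : ℕ) → d < j → h n j ≡ 0ℤ)
               × ((i j : ℕ) → infProd i j ≡ rhsSeries i j)
mainTheorem2 = h-polynomial , λ i j →
  ≡.trans (prodUpTo≈finiteProd j i j) (≡.trans (finiteProd-agree j i j ℕₚ.≤-refl) (≡.sym (rhsSeries≈rhsCoeff i j)))
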